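{- Let $a,b$ be positive integers, $A=(a,a)$, $B=(b,b)$, and let $(S(i))_{i\ge0}$ be the ordered Markov sequences for $A$ and $B$. Then for every integer $k\ge2$, \[ |S(k)|=|S(a(k))|+|S(a(k-1))|, \] where $|X|$ denotes the length of a sequence $X$.
   Context: For finite sequences $X,Y$, $X\oplus Y$ denotes concatenation. For a triple $(X,Y,Z)$ of finite sequences put $\mathcal{L}(X,Y,Z)=(X,X\oplus Y,Y)$ and $\mathcal{R}(X,Y,Z)=(Y,Y\oplus Z,Z)$. Let $v=(A,A\oplus B,B)$. For $m\ge1$ the $2^m$ triples at depth $m$ are $\varepsilon_m(\cdots\varepsilon_1(v)\cdots)$ for words $(\varepsilon_1,\ldots,\varepsilon_m)\in\{\mathcal{L},\mathcal{R}\}^m$ ($\varepsilon_1$ applied first), listed in lexicographic order with $\mathcal{L}<\mathcal{R}$. The ordered Markov sequences are $S(0)=A$, $S(1)=B$, $S(2)=A\oplus B$, and for $m\ge1$, $1\le i\le2^m$, $S(2^m+i)$ is the middle component of the $i$-th triple at depth $m$. The sequence $(a(j))_{j\ge1}$ is defined by $a(1)=a(2)=1$ and, for $j>1$, $a(2j)=a(j)$, $a(2j-1)=j$. -}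

module Defs where

open import Data.Nat using (ℕ; zero; suc; _+_; _*_; _∸_; _^_; _≡ᵇ_)
open import Data.Nat.DivMod using (_/_; _%_)
open import Data.Nat.Logarithm using (⌊log₂_⌋)
open import Data.List using (List; []; _∷_; _++_; map; concatMap; drop)
open import Data.Bool using (if_then_else_)
open import Data.Product using (_×_; _,_)

Seq : Set
Seq = List ℕ

Triple : Set
Triple = Seq × Seq × Seq

middle : Triple → Seq
middle (_ , Y , _) = Y

𝓛 : Triple → Triple
𝓛 (X , Y , Z) = (X , X ++ Y , Y)

𝓡 : Triple → Triple
𝓡 (X , Y , Z) = (Y , Y ++ Z , Z)

root : Seq → Seq → Triple
root A B = (A , A ++ B , B)

-- triples at depth m, in lexicographic order of the words (ε₁,…,εₘ)
-- with 𝓛 < 𝓡 (ε₁ applied first, hence most significant letter).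
triples : Seq → Seq → ℕ → List Triple
triples A B zero    = root A B ∷ []
triples A B (suc m) = concatMap (λ t → 𝓛 t ∷ 𝓡 t ∷ []) (triples A B m)

nth : {X : Set} → X → ℕ → List X → X
nth d i xs with drop i xs
... | []    = d
... | x ∷ _ = x

-- ordered Markov sequences:
-- S 0 = A, S 1 = B, S 2 = A ⊕ B, and for n = 2^m + i with m ≥ 1, 1 ≤ i ≤ 2^m,
-- S n = middle of the i-th triple at depth m.  For n ≥ 3 we have
-- m = ⌊log₂ (n ∸ 1)⌋ and i = n ∸ 2^m.
S : Seq → Seq → ℕ → Seq
S A B zero             = A
S A B (suc zero)       = B
S A B (suc (suc zero)) = A ++ B
S A B n@(suc (suc (suc _))) =
  let m = ⌊log₂ (n ∸ 1) ⌋ in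
  middle (nth (root A B) (n ∸ 2 ^ m ∸ 1) (triples A B m))

-- the sequence a(j): a(1) = a(2) = 1, a(2j) = a(j), a(2j-1) = j (j > 1).
-- Computed with fuel (fuel n suffices for argument n since it halves).
aFuel : ℕ → ℕ → ℕ
aFuel zero    n = 1
aFuel (suc f) n =
  if n % 2 ≡ᵇ 0 then aFuel f (n / 2) else (n + 1) / 2

aseq : ℕ → ℕ
aseq n = aFuel n n

-- Number the triples of the Markov tree heap-style: the root has index 1 and the
-- children of index n are 2n (via 𝓛) and 2n + 1 (via 𝓡), so the j-th triple at
-- depth m has index n = 2^m + j and its middle component is S(n + 1). Going down
-- the tree one shows that every triple (X, X ⊕ Z, Z) at index n satisfies
-- |X| = |S(a(n))| and |Z| = |S(a(n + 1))|: 𝓛 keeps X and makes the old middle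
-- S(n + 1) the new right end, matching a(2n) = a(n) and a(2n + 1) = n + 1, and 𝓡
-- is symmetric. Reading off the middle of the triple at index k − 1 gives the
-- identity.
module Submission where

open import Defs
open import Data.Nat using (ℕ; zero; suc; _+_; _*_; _∸_; _^_; _≤_; _<_; z≤n; s≤s; ⌊_/2⌋)
open import Data.Nat.Properties
open import Data.Nat.DivMod using (_%_; _/_; m*n%n≡0; m*n/n≡m; [m+kn]%n≡m%n)
open import Data.Nat.Logarithm using (⌊log₂_⌋; ⌊log₂⌊n/2⌋⌋≡⌊log₂n⌋∸1; ⌊log₂⌋-mono-≤; ⌊log₂[2^n]⌋≡n)
open import Data.List using (List; _∷_; []; _++_; length; concatMap)
open import Data.List.Properties using (length-++)
open import Data.Product using (Σ-syntax; _×_; _,_)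
open import Data.Sum using (inj₁; inj₂)
open import Function using (_∘_)
open import Relation.Binary.PropositionalEquality
  using (_≡_; refl; sym; trans; cong; cong₂; subst; subst₂; module ≡-Reasoning)

open ≡-Reasoning

-- Unlike 2 * n, double n computes to suc (suc …), as list indexing and the parity view need.
double : ℕ → ℕ
double zero    = zero
double (suc n) = suc (suc (double n))

double≡*2 : ∀ n → double n ≡ n * 2
double≡*2 zero    = refl
double≡*2 (suc n) = cong (λ x → suc (suc x)) (double≡*2 n)

2^suc≡double : ∀ m → 2 ^ suc m ≡ double (2 ^ m)
2^suc≡double m = trans (*-comm 2 (2 ^ m)) (sym (double≡*2 (2 ^ m)))

double-+ : ∀ m n → double (m + n) ≡ double m + double n
double-+ zero    n = refl
double-+ (suc m) n = cong (λ x → suc (suc x)) (double-+ m n)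

n≤double : ∀ n → n ≤ double n
n≤double zero    = z≤n
n≤double (suc n) = s≤s (m≤n⇒m≤1+n (n≤double n))

double-cancel-< : ∀ {m n} → double m < double n → m < n
double-cancel-< {zero}  {suc n} _                 = s≤s z≤n
double-cancel-< {suc m} {suc n} (s≤s (s≤s 2m<2n)) = s≤s (double-cancel-< 2m<2n)

double[2^m+i]≡2^[1+m]+double[i] : ∀ m i → double (2 ^ m + i) ≡ 2 ^ suc m + double i
double[2^m+i]≡2^[1+m]+double[i] m i = trans (double-+ (2 ^ m) i) (cong (_+ double i) (sym (2^suc≡double m)))

double<2^suc⇒<2^ : ∀ m {i} → double i < 2 ^ suc m → i < 2 ^ m
double<2^suc⇒<2^ m {i} = double-cancel-< ∘ subst (double i <_) (2^suc≡double m)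

data ParityView : ℕ → Set where
  even : ∀ k → ParityView (double k)
  odd  : ∀ k → ParityView (suc (double k))

parityView : ∀ n → ParityView n
parityView zero = even zero
parityView (suc n) with parityView n
... | even k = odd k
... | odd k  = even (suc k)

⌊double+n/2⌋ : ∀ m n → ⌊ double m + n /2⌋ ≡ m + ⌊ n /2⌋
⌊double+n/2⌋ zero    n = refl
⌊double+n/2⌋ (suc m) n = cong suc (⌊double+n/2⌋ m n)

⌊n/2⌋<-double : ∀ {m n} → m < double n → ⌊ m /2⌋ < n
⌊n/2⌋<-double {zero}        {suc n} _                = s≤s z≤n
⌊n/2⌋<-double {suc zero}    {suc n} _                = s≤s z≤n
⌊n/2⌋<-double {suc (suc m)} {suc n} (s≤s (s≤s m<2n)) = s≤s (⌊n/2⌋<-double m<2n)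

⌊log₂[2^m+j]⌋≡m : ∀ m {j} → j < 2 ^ m → ⌊log₂ (2 ^ m + j) ⌋ ≡ m
⌊log₂[2^m+j]⌋≡m zero    {zero}  _         = refl
⌊log₂[2^m+j]⌋≡m zero    {suc j} (s≤s ())
⌊log₂[2^m+j]⌋≡m (suc m) {j}    j<2^sm = begin
  ⌊log₂ n ⌋             ≡⟨ sym (m∸n+n≡m 1≤log) ⟩
  ⌊log₂ n ⌋ ∸ 1 + 1     ≡⟨ cong (_+ 1) log-pred ⟩
  m + 1                 ≡⟨ +-comm m 1 ⟩
  suc m                 ∎
  where
  n : ℕ
  n = 2 ^ suc m + j
  j<2·2^m : j < double (2 ^ m)
  j<2·2^m = subst (j <_) (2^suc≡double m) j<2^sm
  ⌊n/2⌋≡ : ⌊ n /2⌋ ≡ 2 ^ m + ⌊ j /2⌋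
  ⌊n/2⌋≡ = trans (cong (λ x → ⌊ x + j /2⌋) (2^suc≡double m)) (⌊double+n/2⌋ (2 ^ m) j)
  log-pred : ⌊log₂ n ⌋ ∸ 1 ≡ m
  log-pred = begin
    ⌊log₂ n ⌋ ∸ 1                ≡⟨ sym (⌊log₂⌊n/2⌋⌋≡⌊log₂n⌋∸1 n) ⟩
    ⌊log₂ ⌊ n /2⌋ ⌋              ≡⟨ cong ⌊log₂_⌋ ⌊n/2⌋≡ ⟩
    ⌊log₂ (2 ^ m + ⌊ j /2⌋) ⌋    ≡⟨ ⌊log₂[2^m+j]⌋≡m m (⌊n/2⌋<-double j<2·2^m) ⟩
    m                            ∎
  1≤log : 1 ≤ ⌊log₂ n ⌋
  1≤log = ≤-trans (s≤s z≤n)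
    (subst (_≤ ⌊log₂ n ⌋) (⌊log₂[2^n]⌋≡n (suc m)) (⌊log₂⌋-mono-≤ (m≤m+n (2 ^ suc m) j)))

binary-split : ∀ n → 1 ≤ n → Σ[ m ∈ ℕ ] Σ[ j ∈ ℕ ] j < 2 ^ m × n ≡ 2 ^ m + j
binary-split (suc zero)    _ = 0 , 0 , s≤s z≤n , refl
binary-split (suc (suc n)) _ with binary-split (suc n) (s≤s z≤n)
... | m , j , j<2^m , 1+n≡2^m+j with m≤n⇒m<n∨m≡n j<2^m
...   | inj₁ 1+j<2^m = m , suc j , 1+j<2^m , trans (cong suc 1+n≡2^m+j) (sym (+-suc (2 ^ m) j))
...   | inj₂ 1+j≡2^m = suc m , 0 , m^n>0 2 (suc m) , (begin
  suc (suc n)            ≡⟨ cong suc 1+n≡2^m+j ⟩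
  suc (2 ^ m + j)        ≡⟨ +-suc (2 ^ m) j ⟨
  2 ^ m + suc j          ≡⟨ cong (2 ^ m +_) 1+j≡2^m ⟩
  2 ^ m + 2 ^ m          ≡⟨ cong (2 ^ m +_) (+-identityʳ (2 ^ m)) ⟨
  2 ^ suc m              ≡⟨ +-identityʳ (2 ^ suc m) ⟨
  2 ^ suc m + 0          ∎)

aFuel-zero : ∀ f → aFuel f 0 ≡ 1
aFuel-zero zero    = refl
aFuel-zero (suc f) = aFuel-zero f

aFuel-even : ∀ f n → n % 2 ≡ 0 → aFuel (suc f) n ≡ aFuel f (n / 2)
aFuel-even f n n%2≡0 rewrite n%2≡0 = refl

aFuel-odd : ∀ f n → n % 2 ≡ 1 → aFuel (suc f) n ≡ (n + 1) / 2
aFuel-odd f n n%2≡1 rewrite n%2≡1 = refl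

aFuel-double : ∀ f k → aFuel (suc f) (double k) ≡ aFuel f k
aFuel-double f k = begin
  aFuel (suc f) (double k)  ≡⟨ cong (aFuel (suc f)) (double≡*2 k) ⟩
  aFuel (suc f) (k * 2)     ≡⟨ aFuel-even f (k * 2) (m*n%n≡0 k 2) ⟩
  aFuel f (k * 2 / 2)       ≡⟨ cong (aFuel f) (m*n/n≡m k 2) ⟩
  aFuel f k                 ∎

aFuel-suc-double : ∀ f k → aFuel (suc f) (suc (double k)) ≡ suc k
aFuel-suc-double f k = begin
  aFuel (suc f) (suc (double k))  ≡⟨ cong (λ x → aFuel (suc f) (suc x)) (double≡*2 k) ⟩
  aFuel (suc f) (1 + k * 2)       ≡⟨ aFuel-odd f (1 + k * 2) ([m+kn]%n≡m%n 1 k 2) ⟩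
  (1 + k * 2 + 1) / 2             ≡⟨ cong (_/ 2) (+-comm (1 + k * 2) 1) ⟩
  suc k * 2 / 2                   ≡⟨ m*n/n≡m (suc k) 2 ⟩
  suc k                           ∎

aFuel-fuel-irrelevant : ∀ {f g} n → n ≤ f → n ≤ g → aFuel f n ≡ aFuel g n
aFuel-fuel-irrelevant n = by-parity (parityView n)
  where
  by-parity : ∀ {f g n} → ParityView n → n ≤ f → n ≤ g → aFuel f n ≡ aFuel g n
  by-parity {f} {g} (even zero) _ _ = trans (aFuel-zero f) (sym (aFuel-zero g))
  by-parity {suc f} {suc g} (even (suc k)) (s≤s 1+2k≤f) (s≤s 1+2k≤g) = begin
    aFuel (suc f) (double (suc k))  ≡⟨ aFuel-double f (suc k) ⟩
    aFuel f (suc k)                 ≡⟨ aFuel-fuel-irrelevant (suc k) (bound 1+2k≤f) (bound 1+2k≤g) ⟩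
    aFuel g (suc k)                 ≡⟨ aFuel-double g (suc k) ⟨
    aFuel (suc g) (double (suc k))  ∎
    where
    bound : ∀ {h} → suc (double k) ≤ h → suc k ≤ h
    bound = ≤-trans (s≤s (n≤double k))
  by-parity {suc f} {suc g} (odd k) _ _ = trans (aFuel-suc-double f k) (sym (aFuel-suc-double g k))

aseq-double : ∀ {n} → 1 ≤ n → aseq (double n) ≡ aseq n
aseq-double {suc k} _ = begin
  aFuel (suc (suc (double k))) (double (suc k))  ≡⟨ aFuel-double (suc (double k)) (suc k) ⟩
  aFuel (suc (double k)) (suc k)                 ≡⟨ aFuel-fuel-irrelevant (suc k) (s≤s (n≤double k)) ≤-refl ⟩
  aFuel (suc k) (suc k)                          ∎

aseq-suc-double : ∀ n → aseq (suc (double n)) ≡ suc n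
aseq-suc-double n = aFuel-suc-double (double n) n

module _ {X Y : Set} (f g : X → Y) where

  interleave : List X → List Y
  interleave = concatMap (λ x → f x ∷ g x ∷ [])

  length-interleave : ∀ xs → length (interleave xs) ≡ double (length xs)
  length-interleave []       = refl
  length-interleave (x ∷ xs) = cong (λ n → suc (suc n)) (length-interleave xs)

  nth-interleave-even : ∀ d e xs {i} → i < length xs → nth e (double i) (interleave xs) ≡ f (nth d i xs)
  nth-interleave-even d e (x ∷ xs) {zero}  _         = refl
  nth-interleave-even d e (x ∷ xs) {suc i} (s≤s i<n) = nth-interleave-even d e xs i<n

  nth-interleave-odd : ∀ d e xs {i} → i < length xs → nth e (suc (double i)) (interleave xs) ≡ g (nth d i xs)
  nth-interleave-odd d e (x ∷ xs) {zero}  _         = refl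
  nth-interleave-odd d e (x ∷ xs) {suc i} (s≤s i<n) = nth-interleave-odd d e xs i<n

first last : Triple → Seq
first (X , _ , _) = X
last  (_ , _ , Z) = Z

module _ (A B : Seq) where

  -- Indexed from 0: triple m j is the (j + 1)-th triple at depth m of the paper.
  triple : ℕ → ℕ → Triple
  triple m j = nth (root A B) j (triples A B m)

  length-triples : ∀ m → length (triples A B m) ≡ 2 ^ m
  length-triples zero    = refl
  length-triples (suc m) = begin
    length (triples A B (suc m))     ≡⟨ length-interleave 𝓛 𝓡 (triples A B m) ⟩
    double (length (triples A B m))  ≡⟨ cong double (length-triples m) ⟩
    double (2 ^ m)                   ≡⟨ 2^suc≡double m ⟨
    2 ^ suc m                        ∎

  triple-𝓛 : ∀ m {i} → i < 2 ^ m → triple (suc m) (double i) ≡ 𝓛 (triple m i)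
  triple-𝓛 m i<2^m =
    nth-interleave-even 𝓛 𝓡 _ _ (triples A B m) (subst (_ <_) (sym (length-triples m)) i<2^m)

  triple-𝓡 : ∀ m {i} → i < 2 ^ m → triple (suc m) (suc (double i)) ≡ 𝓡 (triple m i)
  triple-𝓡 m i<2^m =
    nth-interleave-odd 𝓛 𝓡 _ _ (triples A B m) (subst (_ <_) (sym (length-triples m)) i<2^m)

  S-unfold : ∀ n → 2 ≤ n →
    S A B (suc n) ≡ middle (nth (root A B) (suc n ∸ 2 ^ ⌊log₂ n ⌋ ∸ 1) (triples A B ⌊log₂ n ⌋))
  S-unfold (suc (suc n)) _         = refl
  S-unfold (suc zero)    (s≤s ())

  S-middle : ∀ m {j} → j < 2 ^ m → S A B (suc (2 ^ m + j)) ≡ middle (triple m j)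
  S-middle zero    {zero}  _   = refl
  S-middle zero    {suc j} (s≤s ())
  S-middle (suc m) {j} j<2^sm = begin
    S A B (suc n)
      ≡⟨ S-unfold n 2≤n ⟩
    middle (nth (root A B) (suc n ∸ 2 ^ ⌊log₂ n ⌋ ∸ 1) (triples A B ⌊log₂ n ⌋))
      ≡⟨ cong (λ l → middle (nth (root A B) (suc n ∸ 2 ^ l ∸ 1) (triples A B l))) (⌊log₂[2^m+j]⌋≡m (suc m) j<2^sm) ⟩
    middle (nth (root A B) (suc n ∸ 2 ^ suc m ∸ 1) (triples A B (suc m)))
      ≡⟨ cong (λ i → middle (nth (root A B) (i ∸ 1) (triples A B (suc m)))) offset ⟩
    middle (triple (suc m) j)
      ∎
    where
    n : ℕ
    n = 2 ^ suc m + j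
    2≤n : 2 ≤ n
    2≤n = ≤-trans (^-monoʳ-≤ 2 {1} {suc m} (s≤s z≤n)) (m≤m+n (2 ^ suc m) j)
    offset : suc n ∸ 2 ^ suc m ≡ suc j
    offset = trans (cong (_∸ 2 ^ suc m) (sym (+-suc (2 ^ suc m) j))) (m+n∸m≡n (2 ^ suc m) (suc j))

  ∣S∣ : ℕ → ℕ
  ∣S∣ n = length (S A B n)

  record Fits (n : ℕ) (t : Triple) : Set where
    field
      middle≡first++last : middle t ≡ first t ++ last t
      length-first       : length (first t) ≡ ∣S∣ (aseq n)
      length-last        : length (last t) ≡ ∣S∣ (aseq (suc n))

  open Fits

  𝓛-fits : ∀ {n} t → 1 ≤ n → Fits n t → length (middle t) ≡ ∣S∣ (suc n) → Fits (double n) (𝓛 t)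
  𝓛-fits {n} (X , Y , Z) 1≤n t-fits |Y| = record
    { middle≡first++last = refl
    ; length-first       = trans (length-first t-fits) (cong ∣S∣ (sym (aseq-double 1≤n)))
    ; length-last        = trans |Y| (cong ∣S∣ (sym (aseq-suc-double n)))
    }

  𝓡-fits : ∀ {n} t → Fits n t → length (middle t) ≡ ∣S∣ (suc n) → Fits (suc (double n)) (𝓡 t)
  𝓡-fits {n} (X , Y , Z) t-fits |Y| = record
    { middle≡first++last = refl
    ; length-first       = trans |Y| (cong ∣S∣ (sym (aseq-suc-double n)))
    ; length-last        = trans (length-last t-fits) (cong ∣S∣ (sym (aseq-double {suc n} (s≤s z≤n))))
    }

  triple-fits : length A ≡ length B → ∀ m {j} → j < 2 ^ m → Fits (2 ^ m + j) (triple m j)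
  triple-fits |A|≡|B| zero {zero} _ = record
    { middle≡first++last = refl
    ; length-first       = |A|≡|B|
    ; length-last        = refl
    }
  triple-fits _       zero {suc j} (s≤s ())
  triple-fits |A|≡|B| (suc m) {j} = child (parityView j)
    where
    parent-fits : ∀ {i} (i<2^m : i < 2 ^ m) → Fits (2 ^ m + i) (triple m i)
    parent-fits = triple-fits |A|≡|B| m

    |parent-middle| : ∀ {i} (i<2^m : i < 2 ^ m) → length (middle (triple m i)) ≡ ∣S∣ (suc (2 ^ m + i))
    |parent-middle| i<2^m = cong length (sym (S-middle m i<2^m))

    child : ∀ {j} → ParityView j → j < 2 ^ suc m → Fits (2 ^ suc m + j) (triple (suc m) j)
    child (even i) 2i<2^sm = subst₂ Fits (double[2^m+i]≡2^[1+m]+double[i] m i) (sym (triple-𝓛 m i<2^m))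
        (𝓛-fits (triple m i) (≤-trans (m^n>0 2 m) (m≤m+n (2 ^ m) i)) (parent-fits i<2^m) (|parent-middle| i<2^m))
      where
      i<2^m : i < 2 ^ m
      i<2^m = double<2^suc⇒<2^ m 2i<2^sm
    child (odd i) 2i+1<2^sm = subst₂ Fits index (sym (triple-𝓡 m i<2^m))
        (𝓡-fits (triple m i) (parent-fits i<2^m) (|parent-middle| i<2^m))
      where
      i<2^m : i < 2 ^ m
      i<2^m = double<2^suc⇒<2^ m (≤-trans (n≤1+n _) 2i+1<2^sm)
      index : suc (double (2 ^ m + i)) ≡ 2 ^ suc m + suc (double i)
      index = trans (cong suc (double[2^m+i]≡2^[1+m]+double[i] m i)) (sym (+-suc (2 ^ suc m) (double i)))

  ∣S∣-recurrence : length A ≡ length B → ∀ k → 2 ≤ k → ∣S∣ k ≡ ∣S∣ (aseq k) + ∣S∣ (aseq (k ∸ 1))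
  ∣S∣-recurrence |A|≡|B| (suc n) (s≤s 1≤n) with binary-split n 1≤n
  ... | m , j , j<2^m , refl = begin
    ∣S∣ (suc n)                               ≡⟨ cong length (S-middle m j<2^m) ⟩
    length (middle t)                         ≡⟨ cong length (middle≡first++last t-fits) ⟩
    length (first t ++ last t)                ≡⟨ length-++ (first t) ⟩
    length (first t) + length (last t)        ≡⟨ cong₂ _+_ (length-first t-fits) (length-last t-fits) ⟩
    ∣S∣ (aseq n) + ∣S∣ (aseq (suc n))         ≡⟨ +-comm (∣S∣ (aseq n)) _ ⟩
    ∣S∣ (aseq (suc n)) + ∣S∣ (aseq n)         ∎
    where
    t : Triple
    t = triple m j
    t-fits : Fits (2 ^ m + j) t
    t-fits = triple-fits |A|≡|B| m j<2^m

lemma2p11 : (a b : ℕ) → 1 ≤ a → 1 ≤ b → (k : ℕ) → 2 ≤ k →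
    length (S (a ∷ a ∷ []) (b ∷ b ∷ []) k)
      ≡ length (S (a ∷ a ∷ []) (b ∷ b ∷ []) (aseq k))
        + length (S (a ∷ a ∷ []) (b ∷ b ∷ []) (aseq (k ∸ 1)))
lemma2p11 a b _ _ = ∣S∣-recurrence (a ∷ a ∷ []) (b ∷ b ∷ []) refl
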